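{- Assume the setting and notation described in the context. Then \[ \widetilde{w}(\mathcal{Y}^*)\geq\frac12 w(\mathcal{B}^*_3)+\frac12 w(\mathcal{B}^*_5). \]
   Context: Let $G=(V,E)$ be a complete graph on $n$ vertices with $n$ divisible by 3, and let $w:E\to\mathbb{R}_{\ge 0}$ satisfy the triangle inequality; $w(\cdot)$ of a set of edges or triangles is the total edge weight. A perfect triangle packing is a set of $n/3$ vertex-disjoint triangles, and $\mathcal{B}^*$ is a maximum weight one. Let $\mathcal{C}$ be a cycle packing of $G$ (vertex-disjoint simple cycles of length at least 3 covering all vertices), each cycle oriented arbitrarily. An edge is internal if its endpoints lie on the same cycle of $\mathcal{C}$, and external otherwise. A triangle of $\mathcal{B}^*$ is partial-external if exactly one of its edges is internal, and external if none is. A vertex $x$ of $t$ is an external vertex of $t$ if both edges of $t$ at $x$ are external. If $x'$ is the successor of such an $x$ on its directed cycle, $xx'$ is an out-edge of $t$; $E_t$ is the set of out-edges of $t$. Fix $0\le\tau\le1/3$. A partial-external or external triangle $t$ is type-1 if $w(e)>\frac12(1-\tau)w(t)$ for every $e\in E_t$, and type-2 otherwise. $\mathcal{B}^*_3$ is the set of type-2 partial-external triangles of $\mathcal{B}^*$, and $\mathcal{B}^*_5$ the set of type-2 external triangles. For an edge $xy$ of a cycle $C\in\mathcal{C}$ and a vertex $z\notin C$, $(x,y;z)$ is a triplet. It is good if $w(xy)\le(1-\tau)(w(xz)+w(yz))$. $H$ is the multigraph on $V$ containing, for each good triplet $(x,y;z)$, two edges $xz$ and $yz$, each with augmented weight $w(xz)+w(yz)$.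 $\widetilde{w}$ of a set of edges of $H$ is the sum of augmented weights, and $\mathcal{Y}^*$ is a maximum augmented weight matching of $H$ (of arbitrary size).
   Formalization: The edge weights w and the parameter τ take rational values instead of real ones. -}

module Defs where

open import Data.Nat as ℕ using (ℕ)
open import Data.Fin using (Fin)
open import Data.Bool using (Bool; true; false)
open import Data.List using (List; []; _∷_; _++_; take; concat; concatMap; length)
open import Data.List.Relation.Unary.Any using (Any)
open import Data.List.Relation.Unary.All using (All)
open import Data.List.Relation.Unary.Unique.Propositional using (Unique)
open import Data.List.Membership.Propositional using (_∈_)
open import Data.List.Relation.Binary.Permutation.Propositional using (_↭_)
open import Data.List using (allFin)
open import Data.Product using (Σ; ∃; _×_; _,_)
open import Data.Sum using (_⊎_)
open import Relation.Nullary using (¬_)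
open import Relation.Binary.PropositionalEquality using (_≡_; _≢_)
open import Data.Rational using (ℚ; 0ℚ; 1ℚ; ½; _+_; _*_; _-_; _≤_; _<_)

-- Weighted complete graph on vertex set Fin n, metric weights.
-- w x y is the weight of the edge {x,y} (x ≢ y); w x x is never used.

record MetricWeight (n : ℕ) : Set where
  field
    w        : Fin n → Fin n → ℚ
    w-sym    : ∀ x y → w x y ≡ w y x
    w-nonneg : ∀ x y → x ≢ y → 0ℚ ≤ w x y
    w-tri    : ∀ x y z → x ≢ y → y ≢ z → x ≢ z → w x z ≤ w x y + w y z

-- Cycle packings.  A directed cycle is a list of vertices [v0,…,vk-1];
-- its (oriented) edges are v_i v_{i+1} and v_{k-1} v_0.

data Adjacent {A : Set} : List A → A → A → Set where
  here  : ∀ {x y l} → Adjacent (x ∷ y ∷ l) x y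
  there : ∀ {z x y l} → Adjacent l x y → Adjacent (z ∷ l) x y

CycSucc : {A : Set} → List A → A → A → Set
CycSucc c x y = Adjacent (c ++ take 1 c) x y

-- A cycle packing of K_n: vertex-disjoint simple cycles of length ≥ 3
-- covering all vertices (each given with an orientation = list order).
record CyclePacking (n : ℕ) : Set where
  field
    cycles  : List (List (Fin n))
    len≥3   : All (λ c → 3 ℕ.≤ length c) cycles
    cover   : concat cycles ↭ allFin n

module _ {n : ℕ} (C : CyclePacking n) where
  open CyclePacking C

  Succ : Fin n → Fin n → Set
  Succ x y = Any (λ c → CycSucc c x y) cycles

  SameCycle : Fin n → Fin n → Set
  SameCycle x y = Any (λ c → x ∈ c × y ∈ c) cycles

  Internal : Fin n → Fin n → Set
  Internal = SameCycle

  External : Fin n → Fin n → Set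
  External x y = ¬ SameCycle x y

Triangle : ℕ → Set
Triangle n = Fin n × Fin n × Fin n

verts : ∀ {n} → Triangle n → List (Fin n)
verts (a , b , c) = a ∷ b ∷ c ∷ []

PerfectTrianglePacking : (n : ℕ) → List (Triangle n) → Set
PerfectTrianglePacking n T = (length T ℕ.* 3 ≡ n) × Unique (concatMap verts T)

module _ {n : ℕ} (W : MetricWeight n) where
  open MetricWeight W

  wt : Triangle n → ℚ
  wt (a , b , c) = w a b + w b c + w a c

  wtList : List (Triangle n) → ℚ
  wtList []      = 0ℚ
  wtList (t ∷ T) = wt t + wtList T

  IsMaxPerfectTrianglePacking : List (Triangle n) → Set
  IsMaxPerfectTrianglePacking B =
    PerfectTrianglePacking n B ×
    (∀ T → PerfectTrianglePacking n T → wtList T ≤ wtList B)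

module _ {n : ℕ} (W : MetricWeight n) (C : CyclePacking n) (τ : ℚ) where
  open MetricWeight W

  PartialExternal : Triangle n → Set
  PartialExternal (a , b , c) =
      (Internal C a b × External C b c × External C a c)
    ⊎ (External C a b × Internal C b c × External C a c)
    ⊎ (External C a b × External C b c × Internal C a c)

  ExternalTri : Triangle n → Set
  ExternalTri (a , b , c) = External C a b × External C b c × External C a c

  ExtVertex : Triangle n → Fin n → Set
  ExtVertex t x = x ∈ verts t × (∀ y → y ∈ verts t → y ≢ x → External C x y)

  Type1 : Triangle n → Set
  Type1 t = ∀ x x' → ExtVertex t x → Succ C x x' → ½ * (1ℚ - τ) * wt W t < w x x'

  Type2 : Triangle n → Set
  Type2 t = ¬ Type1 t

  InB3 : Triangle n → Set
  InB3 t = PartialExternal t × Type2 t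

  InB5 : Triangle n → Set
  InB5 t = ExternalTri t × Type2 t

  data SumWhere (P : Triangle n → Set) : List (Triangle n) → ℚ → Set where
    nil  : SumWhere P [] 0ℚ
    yes  : ∀ {t T s} → P t → SumWhere P T s → SumWhere P (t ∷ T) (wt W t + s)
    no   : ∀ {t T s} → ¬ P t → SumWhere P T s → SumWhere P (t ∷ T) s

  -- A good triplet (x,y;z): xy an edge of a cycle of C (x' = successor),
  -- z not on that cycle, w(xy) ≤ (1-τ)(w(xz)+w(yz)).  It contributes two
  -- edges xz (side = true) and yz (side = false) of H.
  record HEdge : Set where
    constructor hedge
    field
      x y z  : Fin n
      xy∈C   : Succ C x y
      z∉C    : ¬ SameCycle C x z
      good   : w x y ≤ (1ℚ - τ) * (w x z + w y z)
      side   : Bool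

  ends : HEdge → List (Fin n)
  ends (hedge x y z _ _ _ true)  = x ∷ z ∷ []
  ends (hedge x y z _ _ _ false) = y ∷ z ∷ []

  aw : HEdge → ℚ
  aw (hedge x y z _ _ _ _) = w x z + w y z

  awList : List HEdge → ℚ
  awList []      = 0ℚ
  awList (e ∷ M) = aw e + awList M

  IsMatching : List HEdge → Set
  IsMatching M = Unique (concatMap ends M)

  IsMaxMatching : List HEdge → Set
  IsMaxMatching Y = IsMatching Y × (∀ M → IsMatching M → awList M ≤ awList Y)

{-# OPTIONS --safe #-}
module Submission where

open import Defs
open import Data.Nat using (ℕ)
open import Data.Nat.Divisibility using (_∣_)
open import Data.List using (List)
open import Data.Rational using (ℚ; 0ℚ; ½; _+_; _*_; _≤_; _/_)
open import Data.Integer using (+_)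

open import Data.Bool using (true)
open import Data.Empty using (⊥-elim)
open import Data.Fin using (Fin)
open import Data.List using ([]; _∷_; _++_; take; concatMap)
open import Data.List.Membership.Propositional using (_∈_)
open import Data.List.Membership.Propositional.Properties using (∈-++⁻)
open import Data.List.Relation.Binary.Disjoint.Propositional using (Disjoint)
open import Data.List.Relation.Binary.Subset.Propositional using (_⊆_)
open import Data.List.Relation.Binary.Subset.Propositional.Properties using (xs⊆ys++xs)
  renaming (++⁺ to ++⁺-⊆)
open import Data.List.Relation.Unary.All as All using ([]; _∷_)
import Data.List.Relation.Unary.All.Properties as All
open import Data.List.Relation.Unary.AllPairs using ([]; _∷_)
open import Data.List.Relation.Unary.Any as Any using (here; there)
open import Data.List.Relation.Unary.Unique.Propositional using (Unique)
open import Data.List.Relation.Unary.Unique.Propositional.Properties using ()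
  renaming (++⁺ to ++⁺-Unique)
open import Data.Product using (Σ-syntax; _×_; _,_; proj₂)
open import Data.Rational using (1ℚ; _-_; -_; nonNegative)
open import Data.Rational.Properties as QP using (≤-reflexive; ≤-trans; module ≤-Reasoning)
open import Data.Rational.Solver using (module +-*-Solver)
open import Algebra.Bundles using (CommutativeMonoid)
open import Algebra.Properties.CommutativeSemigroup
  (CommutativeMonoid.commutativeSemigroup QP.+-0-commutativeMonoid) using (x∙yz≈y∙xz)
open import Data.Sum using (_⊎_; inj₁; inj₂; [_,_])
open import Effect.Monad using (RawMonad)
open import Function using (_∘_)
open import Level using (0ℓ)
open import Relation.Binary.PropositionalEquality using (_≡_; _≢_; refl; sym; trans; cong; cong₂; subst)
open import Relation.Nullary using (¬_)
open import Relation.Nullary.Decidable using (decidable-stable; from-yes)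
open import Relation.Nullary.Negation using (¬¬-Monad; ¬¬-map)
open import Relation.Unary using (Pred; _∪_)

open RawMonad (¬¬-Monad {0ℓ})

-- Being type-2, a triangle t of B₃ ∪ B₅ has an external vertex x with out-edge xx' such
-- that w(xx') ≤ ½(1-τ)w(t).  For the other vertices p, q of t the triangle inequality
-- w(pq) ≤ w(px') + w(x'q) gives w(t) ≤ (w(xp) + w(x'p)) + (w(xq) + w(x'q)), so some
-- z ∈ {p, q} has w(xz) + w(x'z) ≥ ½w(t).  Then w(xx') ≤ (1-τ)(w(xz) + w(x'z)), and z is off
-- the cycle of x since xz is external: (x, x'; z) is a good triplet, and its H-edge xz,
-- which lies inside t, has augmented weight at least ½w(t).  The triangles of B* are
-- vertex-disjoint, so these edges form a matching of H of augmented weight at least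
-- ½w(B₃) + ½w(B₅).

Adjacent⇒∈ : ∀ {A : Set} {l : List A} {x y} → Adjacent l x y → x ∈ l × y ∈ l
Adjacent⇒∈ here      = here refl , there (here refl)
Adjacent⇒∈ (there a) = let x∈l , y∈l = Adjacent⇒∈ a in there x∈l , there y∈l

∈-++-take⁻ : ∀ {A : Set} (c : List A) {v} → v ∈ c ++ take 1 c → v ∈ c
∈-++-take⁻ c v∈ with ∈-++⁻ c v∈
... | inj₁ v∈c = v∈c
∈-++-take⁻ (_ ∷ _) _ | inj₂ (here refl) = here refl

CycSucc⇒∈ : ∀ {A : Set} (c : List A) {x y} → CycSucc c x y → x ∈ c × y ∈ c
CycSucc⇒∈ c s = let x∈ , y∈ = Adjacent⇒∈ s in ∈-++-take⁻ c x∈ , ∈-++-take⁻ c y∈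

Unique-++⁻ : ∀ {A : Set} (xs : List A) {ys} →
             Unique (xs ++ ys) → Unique xs × Unique ys × Disjoint xs ys
Unique-++⁻ []       u = [] , u , λ ()
Unique-++⁻ (x ∷ xs) (x≢xs++ys ∷ u) with Unique-++⁻ xs u
... | uxs , uys , disjoint = All.++⁻ˡ xs x≢xs++ys ∷ uxs , uys , λ where
  (here refl  , v∈ys) → All.lookup (All.++⁻ʳ xs x≢xs++ys) v∈ys refl
  (there v∈xs , v∈ys) → disjoint (v∈xs , v∈ys)

p≤q⇒0≤q-p : ∀ {p q} → p ≤ q → 0ℚ ≤ q - p
p≤q⇒0≤q-p {p} {q} p≤q = begin
  0ℚ     ≡⟨ sym (QP.+-inverseʳ p) ⟩
  p - p  ≤⟨ QP.+-monoˡ-≤ (- p) p≤q ⟩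
  q - p  ∎
  where open ≤-Reasoning

½*[p+p]≡p : ∀ p → ½ * (p + p) ≡ p
½*[p+p]≡p = solve 1 (λ p → con ½ :* (p :+ p) := p) refl
  where open +-*-Solver

p≤a+a⇒½p≤a : ∀ {p a} → p ≤ a + a → ½ * p ≤ a
p≤a+a⇒½p≤a {p} {a} p≤a+a = begin
  ½ * p        ≤⟨ QP.*-monoˡ-≤-nonNeg ½ p≤a+a ⟩
  ½ * (a + a)  ≡⟨ ½*[p+p]≡p a ⟩
  a            ∎
  where open ≤-Reasoning

p≤a+b⇒½p≤a⊎½p≤b : ∀ {p a b} → p ≤ a + b → ½ * p ≤ a ⊎ ½ * p ≤ b
p≤a+b⇒½p≤a⊎½p≤b {p} {a} {b} p≤a+b with QP.≤-total b a
... | inj₁ b≤a = inj₁ (p≤a+a⇒½p≤a (≤-trans p≤a+b (QP.+-monoʳ-≤ a b≤a)))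
... | inj₂ a≤b = inj₂ (p≤a+a⇒½p≤a (≤-trans p≤a+b (QP.+-monoˡ-≤ b a≤b)))

p≤½rs⇒p≤ra : ∀ {p r s a} → 0ℚ ≤ r → p ≤ ½ * r * s → ½ * s ≤ a → p ≤ r * a
p≤½rs⇒p≤ra {p} {r} {s} {a} 0≤r p≤½rs ½s≤a = begin
  p            ≤⟨ p≤½rs ⟩
  ½ * r * s    ≡⟨ cong (_* s) (QP.*-comm ½ r) ⟩
  r * ½ * s    ≡⟨ QP.*-assoc r ½ s ⟩
  r * (½ * s)  ≤⟨ QP.*-monoˡ-≤-nonNeg r {{nonNegative 0≤r}} ½s≤a ⟩
  r * a        ∎
  where open ≤-Reasoning

Succ⇒SameCycle : ∀ {n} (C : CyclePacking n) {x y} → Succ C x y → SameCycle C x y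
Succ⇒SameCycle C = Any.map λ {c} → CycSucc⇒∈ c

External⇒≢Succ : ∀ {n} (C : CyclePacking n) {x x' y} →
                 Succ C x x' → External C x y → y ≢ x'
External⇒≢Succ C x→x' x≁y refl = x≁y (Succ⇒SameCycle C x→x')

PartialExternal⇒¬ExternalTri : ∀ {n} (W : MetricWeight n) (C : CyclePacking n) τ {t} →
  PartialExternal W C τ t → ¬ ExternalTri W C τ t
PartialExternal⇒¬ExternalTri W C τ (inj₁ (ab , _))               (a≁b , _)       = a≁b ab
PartialExternal⇒¬ExternalTri W C τ (inj₂ (inj₁ (_ , bc , _)))    (_ , b≁c , _)   = b≁c bc
PartialExternal⇒¬ExternalTri W C τ (inj₂ (inj₂ (_ , _ , ac)))    (_ , _ , a≁c)   = a≁c ac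

module _ {n : ℕ} (W : MetricWeight n) where
  open MetricWeight W

  record OtherVertices (t : Triangle n) (x : Fin n) : Set where
    field
      {p q} : Fin n
      p∈t   : p ∈ verts t
      q∈t   : q ∈ verts t
      x≢p   : x ≢ p
      x≢q   : x ≢ q
      p≢q   : p ≢ q
      wt≡   : wt W t ≡ w x p + w x q + w p q

  otherVertices : ∀ {t x} → Unique (verts t) → x ∈ verts t → OtherVertices t x
  otherVertices {a , b , c} ((a≢b ∷ a≢c ∷ []) ∷ (b≢c ∷ []) ∷ [] ∷ []) (here refl) = record
    { p∈t = there (here refl) ; q∈t = there (there (here refl))
    ; x≢p = a≢b ; x≢q = a≢c ; p≢q = b≢c
    ; wt≡ = solve 3 (λ ab bc ac → ab :+ bc :+ ac := ab :+ ac :+ bc) refl (w a b) (w b c) (w a c) }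
    where open +-*-Solver
  otherVertices {a , b , c} ((a≢b ∷ a≢c ∷ []) ∷ (b≢c ∷ []) ∷ [] ∷ []) (there (here refl)) = record
    { p∈t = here refl ; q∈t = there (there (here refl))
    ; x≢p = a≢b ∘ sym ; x≢q = b≢c ; p≢q = a≢c
    ; wt≡ = cong (λ ab → ab + w b c + w a c) (w-sym a b) }
  otherVertices {a , b , c} ((a≢b ∷ a≢c ∷ []) ∷ (b≢c ∷ []) ∷ [] ∷ []) (there (there (here refl))) = record
    { p∈t = here refl ; q∈t = there (here refl)
    ; x≢p = a≢c ∘ sym ; x≢q = b≢c ∘ sym ; p≢q = a≢b
    ; wt≡ = trans (solve 3 (λ ab bc ac → ab :+ bc :+ ac := ac :+ bc :+ ab) refl (w a b) (w b c) (w a c))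
                  (cong₂ (λ ca cb → ca + cb + w a b) (w-sym a c) (w-sym b c)) }
    where open +-*-Solver

module _ {n : ℕ} (W : MetricWeight n) (C : CyclePacking n) (τ : ℚ) where
  open MetricWeight W

  LightOutEdge : Triangle n → Set
  LightOutEdge t = Σ[ x ∈ Fin n ] Σ[ x' ∈ Fin n ]
    ExtVertex W C τ t x × Succ C x x' × w x x' ≤ ½ * (1ℚ - τ) * wt W t

  -- Type2 is a negation, so its witness is only available under ¬ ¬; the final
  -- inequality is decidable, which discharges the double negation.
  Type2⇒¬¬LightOutEdge : ∀ {t} → Type2 W C τ t → ¬ ¬ LightOutEdge t
  Type2⇒¬¬LightOutEdge ¬type1 ¬light = ¬type1 λ x x' ext x→x' →
    decidable-stable (_ QP.<? _) λ ¬heavy → ¬light (x , x' , ext , x→x' , QP.≮⇒≥ ¬heavy)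

  record Charge (t : Triangle n) : Set where
    field
      edge       : HEdge W C τ
      ends-unique : Unique (ends W C τ edge)
      ends⊆t     : ends W C τ edge ⊆ verts t
      ½wt≤aw     : ½ * wt W t ≤ aw W C τ edge

  LightOutEdge⇒Charge : 0ℚ ≤ 1ℚ - τ → ∀ {t} → Unique (verts t) → LightOutEdge t → Charge t
  LightOutEdge⇒Charge 0≤1-τ {t} u (x , x' , (x∈t , x≁) , x→x' , light) =
    [ chargeAt p∈t x≢p x≁p , chargeAt q∈t x≢q x≁q ] (p≤a+b⇒½p≤a⊎½p≤b wt≤)
    where
      open OtherVertices (otherVertices W u x∈t)
      x≁p = x≁ p p∈t (x≢p ∘ sym)
      x≁q = x≁ q q∈t (x≢q ∘ sym)

      wt≤ : wt W t ≤ (w x p + w x' p) + (w x q + w x' q)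
      wt≤ = begin
        wt W t                                 ≡⟨ wt≡ ⟩
        w x p + w x q + w p q                  ≤⟨ QP.+-monoʳ-≤ (w x p + w x q)
                                                    (w-tri p x' q (External⇒≢Succ C x→x' x≁p)
                                                                  (External⇒≢Succ C x→x' x≁q ∘ sym) p≢q) ⟩
        w x p + w x q + (w p x' + w x' q)      ≡⟨ cong (λ px' → w x p + w x q + (px' + w x' q)) (w-sym p x') ⟩
        w x p + w x q + (w x' p + w x' q)      ≡⟨ solve 4 (λ xp xq x'p x'q → xp :+ xq :+ (x'p :+ x'q)
                                                                := xp :+ x'p :+ (xq :+ x'q)) refl
                                                    (w x p) (w x q) (w x' p) (w x' q) ⟩
        (w x p + w x' p) + (w x q + w x' q)    ∎
        where
          open ≤-Reasoning
          open +-*-Solver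

      chargeAt : ∀ {z} → z ∈ verts t → x ≢ z → External C x z →
                 ½ * wt W t ≤ w x z + w x' z → Charge t
      chargeAt {z} z∈t x≢z x≁z ½wt≤ = record
        { edge        = hedge x x' z x→x' x≁z (p≤½rs⇒p≤ra 0≤1-τ light ½wt≤) true
        ; ends-unique = (x≢z ∷ []) ∷ [] ∷ []
        ; ends⊆t      = λ where (here refl) → x∈t
                                (there (here refl)) → z∈t
        ; ½wt≤aw      = ½wt≤ }

  SumWhere-∪ : ∀ {P Q : Pred (Triangle n) 0ℓ} → (∀ {t} → P t → ¬ Q t) →
               ∀ {T s s'} → SumWhere W C τ P T s → SumWhere W C τ Q T s' →
               SumWhere W C τ (P ∪ Q) T (s + s')
  SumWhere-∪ P∩Q=∅ nil nil = nil
  SumWhere-∪ P∩Q=∅ (yes p _) (yes q _) = ⊥-elim (P∩Q=∅ p q)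
  SumWhere-∪ P∩Q=∅ (yes {t} {s = s} p ΣP) (no {s = s'} _ ΣQ) =
    subst (SumWhere W C τ _ _) (sym (QP.+-assoc (wt W t) s s')) (yes (inj₁ p) (SumWhere-∪ P∩Q=∅ ΣP ΣQ))
  SumWhere-∪ P∩Q=∅ (no {s = s} _ ΣP) (yes {t} {s = s'} q ΣQ) =
    subst (SumWhere W C τ _ _) (x∙yz≈y∙xz (wt W t) s s') (yes (inj₂ q) (SumWhere-∪ P∩Q=∅ ΣP ΣQ))
  SumWhere-∪ P∩Q=∅ (no ¬p ΣP) (no ¬q ΣQ) = no [ ¬p , ¬q ] (SumWhere-∪ P∩Q=∅ ΣP ΣQ)

  record ChargedMatching (T : List (Triangle n)) (s : ℚ) : Set where
    field
      matching   : List (HEdge W C τ)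
      isMatching : IsMatching W C τ matching
      ends⊆T     : concatMap (ends W C τ) matching ⊆ concatMap verts T
      ½s≤aw      : ½ * s ≤ awList W C τ matching
  open ChargedMatching

  emptyMatching : ChargedMatching [] 0ℚ
  emptyMatching = record
    { matching = [] ; isMatching = [] ; ends⊆T = λ () ; ½s≤aw = ≤-reflexive (QP.*-zeroʳ ½) }

  addCharge : ∀ {t T s} → Disjoint (verts t) (concatMap verts T) →
              Charge t → ChargedMatching T s → ChargedMatching (t ∷ T) (wt W t + s)
  addCharge {t} {T} {s} t#T c M = record
    { matching   = edge ∷ matching M
    ; isMatching = ++⁺-Unique ends-unique (isMatching M) λ (v∈e , v∈M) → t#T (ends⊆t v∈e , ends⊆T M v∈M)
    ; ends⊆T     = ++⁺-⊆ ends⊆t (ends⊆T M)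
    ; ½s≤aw      = begin
        ½ * (wt W t + s)                       ≡⟨ QP.*-distribˡ-+ ½ (wt W t) s ⟩
        ½ * wt W t + ½ * s                     ≤⟨ QP.+-mono-≤ ½wt≤aw (½s≤aw M) ⟩
        aw W C τ edge + awList W C τ (matching M) ∎ }
    where
      open Charge c
      open ≤-Reasoning

  skipTriangle : ∀ t {T s} → ChargedMatching T s → ChargedMatching (t ∷ T) s
  skipTriangle t M = record
    { matching = matching M ; isMatching = isMatching M
    ; ends⊆T = xs⊆ys++xs _ (verts t) ∘ ends⊆T M ; ½s≤aw = ½s≤aw M }

  chargedMatching : ∀ {P : Pred (Triangle n) 0ℓ} →
                    (∀ {t} → P t → Unique (verts t) → ¬ ¬ Charge t) →
                    ∀ {T s} → Unique (concatMap verts T) → SumWhere W C τ P T s →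
                    ¬ ¬ ChargedMatching T s
  chargedMatching charge u nil = pure emptyMatching
  chargedMatching charge {t ∷ T} u (no _ ΣP) =
    let _ , uT , _ = Unique-++⁻ (verts t) u in
    ¬¬-map (skipTriangle t) (chargedMatching charge uT ΣP)
  chargedMatching charge {t ∷ T} u (yes Pt ΣP) = do
    let ut , uT , t#T = Unique-++⁻ (verts t) u
    c ← charge Pt ut
    M ← chargedMatching charge uT ΣP
    pure (addCharge t#T c M)

  Type2⇒¬¬Charge : 0ℚ ≤ 1ℚ - τ → ∀ {t} → Type2 W C τ t → Unique (verts t) → ¬ ¬ Charge t
  Type2⇒¬¬Charge 0≤1-τ type2 u = ¬¬-map (LightOutEdge⇒Charge 0≤1-τ u) (Type2⇒¬¬LightOutEdge type2)

lemma12 : (n : ℕ) → 3 ∣ n → (W : MetricWeight n) → (C : CyclePacking n) →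
          (τ : ℚ) → 0ℚ ≤ τ → τ ≤ + 1 / 3 →
          (Bstar : List (Triangle n)) → IsMaxPerfectTrianglePacking W Bstar →
          (Ystar : List (HEdge W C τ)) → IsMaxMatching W C τ Ystar →
          (s3 s5 : ℚ) → SumWhere W C τ (InB3 W C τ) Bstar s3 →
          SumWhere W C τ (InB5 W C τ) Bstar s5 →
          ½ * s3 + ½ * s5 ≤ awList W C τ Ystar
lemma12 _ _ W C τ _ τ≤⅓ B* (B*-packing , _) Y* (_ , Y*-max) s3 s5 ΣB3 ΣB5 =
  decidable-stable (_ QP.≤? _)
    (¬¬-map bound (chargedMatching W C τ charge (proj₂ B*-packing) (SumWhere-∪ W C τ B3∩B5=∅ ΣB3 ΣB5)))
  where
    0≤1-τ : 0ℚ ≤ 1ℚ - τ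
    0≤1-τ = p≤q⇒0≤q-p (≤-trans τ≤⅓ (from-yes (+ 1 / 3 QP.≤? 1ℚ)))

    B3∩B5=∅ : ∀ {t} → InB3 W C τ t → ¬ InB5 W C τ t
    B3∩B5=∅ (partial , _) (external , _) = PartialExternal⇒¬ExternalTri W C τ partial external

    charge : ∀ {t} → (InB3 W C τ ∪ InB5 W C τ) t → Unique (verts t) → ¬ ¬ Charge W C τ t
    charge = Type2⇒¬¬Charge W C τ 0≤1-τ ∘ [ proj₂ , proj₂ ]

    bound : ChargedMatching W C τ B* (s3 + s5) → ½ * s3 + ½ * s5 ≤ awList W C τ Y*
    bound M = begin
      ½ * s3 + ½ * s5          ≡⟨ QP.*-distribˡ-+ ½ s3 s5 ⟨
      ½ * (s3 + s5)            ≤⟨ ½s≤aw ⟩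
      awList W C τ matching    ≤⟨ Y*-max matching isMatching ⟩
      awList W C τ Y*          ∎
      where
        open ChargedMatching M
        open ≤-Reasoning
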